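{- For $m\ge1$ and $1\le k\le 2m-1$, $K_{2m-1,k}$ equals the number of $\sigma\in\mathcal D^2_{2m}$ with $\sigma(1)=k+1$.
   Context: Let $\mathcal D_{2m+1}$ be the set of permutations $\sigma\in\mathfrak S_{2m+1}$ such that for all $i\in[2m]$, $\sigma(i)>\sigma(i+1)$ if and only if $\sigma(i)$ is even, and $K_{2m-1,k}=\#\{\sigma\in\mathcal D_{2m+1}:\sigma(1)=k+1\}$. A permutation $\sigma\in\mathfrak S_{2m}$ is a Dumont permutation of the second kind if $\sigma(2i)<2i$ and $\sigma(2i-1)\ge 2i-1$ for every $i\in\{1,\dots,m\}$; $\mathcal D^2_{2m}$ denotes the set of these. -}

module Defs where

open import Data.Nat using (ℕ; zero; suc; _+_; _*_; _<_; _≥_; _>_)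
open import Data.Nat.Properties using (_<?_; _≤?_; _≟_)
open import Data.Nat.Divisibility using (_∣_; _∣?_)
open import Data.Fin using (Fin; toℕ; inject₁) renaming (zero to fzero; suc to fsuc)
import Data.Fin.Properties as FinP
open import Data.Vec using (Vec; []; _∷_; lookup)
open import Data.List using (List; []; _∷_; [_]; map; concatMap; length; filter; allFin)
open import Data.Product using (_×_)
open import Relation.Nullary using (Dec; ¬_; ¬?; _×-dec_; _→-dec_)
open import Relation.Binary.PropositionalEquality using (_≡_)
open import Function.Bundles using (_⇔_)
open import Relation.Nullary.Decidable using (yes; no)
open import Function.Bundles using (mk⇔; Equivalence)

_⇔-dec_ : ∀ {a b} {A : Set a} {B : Set b} → Dec A → Dec B → Dec (A ⇔ B)
_⇔-dec_ {A = A} {B} da db with da →-dec db | db →-dec da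
... | yes f | yes g = yes (mk⇔ f g)
... | no nf | _ = no (λ e → nf (Equivalence.to e))
... | yes _ | no ng = no (λ e → ng (Equivalence.from e))

Even : ℕ → Set
Even n = 2 ∣ n

even? : (n : ℕ) → Dec (Even n)
even? n = 2 ∣? n

allVecs : (k n : ℕ) → List (Vec (Fin k) n)
allVecs k zero = [ [] ]
allVecs k (suc n) = concatMap (λ x → map (x ∷_) (allVecs k n)) (allFin k)

-- A word v of length n over Fin n encodes the map σ : [n] → [n],
-- σ(i+1) = toℕ (lookup v i) + 1  (1-based values and positions).
σ : ∀ {n} → Vec (Fin n) n → Fin n → ℕ
σ v i = suc (toℕ (lookup v i))

pos : ∀ {n} → Fin n → ℕ
pos i = suc (toℕ i)

IsPerm : ∀ {n} → Vec (Fin n) n → Set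
IsPerm {n} v = ∀ (i j : Fin n) → lookup v i ≡ lookup v j → i ≡ j

isPerm? : ∀ {n} (v : Vec (Fin n) n) → Dec (IsPerm v)
isPerm? {n} v = FinP.all? λ i → FinP.all? λ j →
  (lookup v i FinP.≟ lookup v j) →-dec (i FinP.≟ j)

InD : ∀ {n} → Vec (Fin (suc n)) (suc n) → Set
InD {n} v = IsPerm v × (∀ (i : Fin n) → (σ v (inject₁ i) > σ v (fsuc i)) ⇔ Even (σ v (inject₁ i)))

inD? : ∀ {n} (v : Vec (Fin (suc n)) (suc n)) → Dec (InD v)
inD? {n} v = isPerm? v ×-dec FinP.all? (λ i →
  (σ v (fsuc i) <? σ v (inject₁ i)) ⇔-dec even? (σ v (inject₁ i)))

-- σ ∈ 𝒟²_{2m} (Dumont permutations of the second kind):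
-- σ(2i) < 2i and σ(2i-1) ≥ 2i-1 for every i ∈ {1..m}. Every position
-- p ∈ [2m] is of exactly one of the forms 2i, 2i-1, so this says:
-- for each position p, if p is even then σ(p) < p, and if p is odd then σ(p) ≥ p.
InD2 : ∀ {n} → Vec (Fin n) n → Set
InD2 {n} v = IsPerm v × (∀ (i : Fin n) →
  (Even (pos i) → σ v i < pos i) × (¬ Even (pos i) → σ v i ≥ pos i))

inD2? : ∀ {n} (v : Vec (Fin n) n) → Dec (InD2 v)
inD2? {n} v = isPerm? v ×-dec FinP.all? (λ i →
  (even? (pos i) →-dec (σ v i <? pos i)) ×-dec (¬? (even? (pos i)) →-dec (pos i ≤? σ v i)))

first : ∀ {n} → Vec (Fin (suc n)) (suc n) → ℕ
first v = σ v fzero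

-- K_{2m-1,k} = #{σ ∈ 𝒟_{2m+1} : σ(1) = k+1}
K : (m k : ℕ) → ℕ
K m k = length (filter (λ v → inD? v ×-dec (first v ≟ suc k)) (allVecs (suc (2 * m)) (suc (2 * m))))

D2count : (n k : ℕ) → ℕ
D2count n k = length (filter (λ v → inD2? v ×-dec (first v ≟ suc k)) (allVecs (suc n) (suc n)))

{-# OPTIONS --safe #-}
-- Foata's fundamental transformation. Cut the one-line word σ(1)…σ(N) of σ ∈ 𝒟_N
-- (N = 2m+1) just after its minimum, then just after the minimum of what is left,
-- and so on, and close every block a … b into the cycle a → … → b → a. Inside a
-- block σ(i) ↦ σ(i+1), so "σ(i) > σ(i+1) iff σ(i) is even" becomes "x > τ(x) iff
-- x is even", the Dumont condition of the second kind. At a block end b both the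
-- next letter of the word and τ(b) are ≥ b, so on both sides the condition says
-- that b is odd. The largest letter N is odd, hence not a descent top, hence last
-- in the word and a fixed point of τ; and τ(1) = σ(1) because 1 closes the first
-- block. This bijection preserves the first value, and Dumont permutations of the
-- second kind of [2m+1] fixing 2m+1 are those of [2m] extended by that fixed point.
module Submission where

open import Data.Empty using (⊥-elim)
open import Data.Fin using (Fin; toℕ; fromℕ; fromℕ<; inject₁; lower₁)
  renaming (zero to fzero; suc to fsuc)
import Data.Fin.Properties as Finₚ
open import Data.List using (List; []; _∷_; _++_; length; map; filter; allFin; concatMap; cartesianProductWith)
import Data.List as List
import Data.List.Properties as Listₚ
open import Data.List.Extrema.Nat using (min; min≤⊤; min≤xs; argmin-sel)
open import Data.List.Membership.Propositional using (_∈_; _∉_)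
open import Data.List.Membership.Propositional.Properties
  using ( ∈-map⁺; ∈-map⁻; ∈-filter⁺; ∈-filter⁻; ∈-++⁺ˡ; ∈-++⁺ʳ; ∈-++⁻; ∈-allFin
        ; ∈-cartesianProductWith⁺; ∈-tabulate⁺; ∈-tabulate⁻)
open import Data.List.Membership.Propositional.Properties.WithK using (unique∧set⇒bag)
import Data.List.Membership.DecPropositional as DecMembership
open import Data.List.Relation.Binary.BagAndSetEquality using (∼bag⇒↭)
open import Data.List.Relation.Binary.Permutation.Propositional.Properties using (↭-length)
open import Data.List.Relation.Unary.All as All using (All; []; _∷_)
import Data.List.Relation.Unary.All.Properties as Allₚ
open import Data.List.Relation.Unary.AllPairs using ([]; _∷_)
open import Data.List.Relation.Unary.Any using (here; there)
import Data.List.Relation.Unary.Any as Any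
open import Data.List.Relation.Unary.Linked using (Linked; []; [-]; _∷_)
open import Data.List.Relation.Unary.Unique.Propositional using (Unique)
import Data.List.Relation.Unary.Unique.Propositional.Properties as Uniqueₚ
open import Data.Maybe using (fromMaybe)
open import Data.Nat using (ℕ; zero; suc; _+_; _*_; _∸_; _≤_; _<_; _>_; _≥_; s≤s; z≤n)
open import Data.Nat.Divisibility using (_∣_; ∣1⇒≡1; ∣m+n∣m⇒∣n; m∣m*n)
import Data.Nat.Properties as ℕₚ
open import Data.Nat.Properties
  using (≤-refl; ≤-reflexive; ≤-antisym; <⇒≤; <⇒≱; ≤⇒≯; ≮⇒≥; <-irrefl; ≤∧≢⇒<; m≤n+m; suc-injective; +-comm)
open import Data.Product using (∃; _×_; _,_; proj₁; proj₂)
open import Data.Sum as Sum using (_⊎_; inj₁; inj₂)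
open import Data.Unit using (⊤; tt)
open import Data.Vec as Vec using (Vec; []; _∷_; _∷ʳ_; lookup; tabulate)
import Data.Vec.Properties as Vecₚ
open import Function.Bundles using (_⇔_; mk⇔; Equivalence)
open import Relation.Binary.Definitions using (DecidableEquality)
open import Relation.Binary.PropositionalEquality
open import Relation.Nullary using (¬_; Dec; yes; no; _×-dec_)
open import Relation.Unary using (Decidable)
open import Defs

private
  variable
    A B : Set
    xs ys : List A

InjectiveOn : (A → B) → List A → Set
InjectiveOn f xs = ∀ {x y} → x ∈ xs → y ∈ xs → f x ≡ f y → x ≡ y

map⁺-injectiveOn : (f : A → B) → Unique xs → InjectiveOn f xs → Unique (map f xs)
map⁺-injectiveOn f [] _ = []
map⁺-injectiveOn f (x∉xs ∷ u) inj =
  All.tabulate (λ fy∈ fx≡fy → let (y , y∈ , fy≡) = ∈-map⁻ f fy∈ in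
    All.lookup x∉xs y∈ (inj (here refl) (there y∈) (trans fx≡fy fy≡)))
  ∷ map⁺-injectiveOn f u (λ x∈ y∈ → inj (there x∈) (there y∈))

unique-sameMembers⇒length≡ : Unique xs → Unique ys → (∀ {x} → x ∈ xs ⇔ x ∈ ys) →
                             length xs ≡ length ys
unique-sameMembers⇒length≡ ux uy xs⇔ys = ↭-length (∼bag⇒↭ (unique∧set⇒bag ux uy xs⇔ys))

bijectiveOn⇒length≡ : (f : A → B) → Unique xs → Unique ys → InjectiveOn f xs →
                      (∀ {x} → x ∈ xs → f x ∈ ys) → (∀ {y} → y ∈ ys → ∃ λ x → x ∈ xs × f x ≡ y) →
                      length xs ≡ length ys
bijectiveOn⇒length≡ {xs = xs} {ys = ys} f ux uy inj into onto =
  trans (sym (Listₚ.length-map f xs)) (unique-sameMembers⇒length≡ (map⁺-injectiveOn f ux inj) uy (mk⇔ to from))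
  where
  to : ∀ {y} → y ∈ map f xs → y ∈ ys
  to fx∈ with _ , x∈ , refl ← ∈-map⁻ f fx∈ = into x∈
  from : ∀ {y} → y ∈ ys → y ∈ map f xs
  from y∈ with _ , x∈ , refl ← onto y∈ = ∈-map⁺ f x∈

injectiveOn⇒surjectiveOn : DecidableEquality A → (f : A → A) → Unique xs → InjectiveOn f xs →
                           (∀ {x} → x ∈ xs → f x ∈ xs) → ∀ {y} → y ∈ xs → ∃ λ x → x ∈ xs × f x ≡ y
injectiveOn⇒surjectiveOn {xs = xs} _≟ᴬ_ f ux inj into {y} y∈ with DecMembership._∈?_ _≟ᴬ_ y (map f xs)
... | yes fx∈ = let (x , x∈ , y≡fx) = ∈-map⁻ f fx∈ in x , x∈ , sym y≡fx
... | no y∉ = ⊥-elim (<-irrefl images-length (Listₚ.filter-notAll image? xs (Any.map (λ { refl → y∉ }) y∈)))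
  where
  image? : ∀ z → Dec (z ∈ map f xs)
  image? z = DecMembership._∈?_ _≟ᴬ_ z (map f xs)
  image⊆ : ∀ {z} → z ∈ map f xs → z ∈ xs
  image⊆ z∈ with _ , x∈ , refl ← ∈-map⁻ f z∈ = into x∈
  images-length : length (filter image? xs) ≡ length xs
  images-length = trans
    (unique-sameMembers⇒length≡ (Uniqueₚ.filter⁺ image? ux) (map⁺-injectiveOn f ux inj)
      (mk⇔ (λ z∈ → proj₂ (∈-filter⁻ image? {xs = xs} z∈)) (λ z∈ → ∈-filter⁺ image? (image⊆ z∈) z∈)))
    (Listₚ.length-map f xs)

concatMap-cartesianProductWith : ∀ {C : Set} (f : A → B → C) xs ys →
  concatMap (λ x → map (f x) ys) xs ≡ cartesianProductWith f xs ys
concatMap-cartesianProductWith f [] ys = refl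
concatMap-cartesianProductWith f (x ∷ xs) ys = cong (map (f x) ys ++_) (concatMap-cartesianProductWith f xs ys)

∈-allVecs : ∀ {k n} (v : Vec (Fin k) n) → v ∈ allVecs k n
∈-allVecs [] = here refl
∈-allVecs {k} {suc n} (x ∷ v) =
  subst (x ∷ v ∈_) (sym (concatMap-cartesianProductWith _∷_ (allFin k) (allVecs k n)))
    (∈-cartesianProductWith⁺ _∷_ (∈-allFin x) (∈-allVecs v))

allVecs-unique : ∀ k n → Unique (allVecs k n)
allVecs-unique k zero = [] ∷ []
allVecs-unique k (suc n) =
  subst Unique (sym (concatMap-cartesianProductWith _∷_ (allFin k) (allVecs k n)))
    (Uniqueₚ.cartesianProductWith⁺ _∷_ Vecₚ.∷-injective (Uniqueₚ.allFin⁺ k) (allVecs-unique k n))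

countVecs : ∀ {k n} {P : Vec (Fin k) n → Set} → Decidable P → ℕ
countVecs {k} {n} P? = length (filter P? (allVecs k n))

countVecs-bijection : ∀ {k n k′ n′} {P : Vec (Fin k) n → Set} {Q : Vec (Fin k′) n′ → Set}
  (P? : Decidable P) (Q? : Decidable Q) (f : Vec (Fin k) n → Vec (Fin k′) n′) →
  (∀ {u v} → P u → P v → f u ≡ f v → u ≡ v) → (∀ {v} → P v → Q (f v)) →
  (∀ {w} → Q w → ∃ λ v → P v × f v ≡ w) → countVecs P? ≡ countVecs Q?
countVecs-bijection {k} {n} {k′} {n′} P? Q? f inj into onto =
  bijectiveOn⇒length≡ f (Uniqueₚ.filter⁺ P? (allVecs-unique k n)) (Uniqueₚ.filter⁺ Q? (allVecs-unique k′ n′))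
    (λ u∈ v∈ → inj (holds P? u∈) (holds P? v∈))
    (λ v∈ → ∈-filter⁺ Q? (∈-allVecs _) (into (holds P? v∈)))
    (λ w∈ → let (v , pv , fv≡w) = onto (holds Q? w∈) in v , ∈-filter⁺ P? (∈-allVecs v) pv , fv≡w)
  where
  holds : ∀ {k n} {R : Vec (Fin k) n → Set} (R? : Decidable R) {v} → v ∈ filter R? (allVecs k n) → R v
  holds {k} {n} R? v∈ = proj₂ (∈-filter⁻ R? {xs = allVecs k n} v∈)

perm-surjective : ∀ {n} {v : Vec (Fin n) n} → IsPerm v → ∀ j → ∃ λ i → lookup v i ≡ j
perm-surjective {n} {v} perm j =
  let (i , _ , vi≡j) = injectiveOn⇒surjectiveOn Finₚ._≟_ (lookup v) (Uniqueₚ.allFin⁺ n)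
                         (λ _ _ → perm _ _) (λ {i} _ → ∈-allFin (lookup v i)) (∈-allFin j)
  in i , vi≡j

lastOr : A → List A → A
lastOr a [] = a
lastOr a (b ∷ r) = lastOr b r

lastOr-∈ : ∀ (a : A) t → lastOr a t ∈ a ∷ t
lastOr-∈ a [] = here refl
lastOr-∈ a (b ∷ t) = there (lastOr-∈ b t)

unique-++⁻ : ∀ xs {ys : List A} → Unique (xs ++ ys) → Unique xs × Unique ys × (∀ {x} → x ∈ xs → x ∉ ys)
unique-++⁻ [] u = [] , u , λ ()
unique-++⁻ (x ∷ xs) (x∉ ∷ u) =
  let (uxs , uys , disjoint) = unique-++⁻ xs u
  in Allₚ.++⁻ˡ xs x∉ ∷ uxs , uys ,
     λ { (here refl) y∈ → All.lookup (Allₚ.++⁻ʳ xs x∉) y∈ refl ; (there x∈) → disjoint x∈ }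

linked-++⁻ : ∀ {R : A → A → Set} a t ys → Linked R (a ∷ t ++ ys) →
             Linked R (a ∷ t) × Linked R ys × (∀ {b bs} → ys ≡ b ∷ bs → R (lastOr a t) b)
linked-++⁻ a [] [] _ = [-] , [] , λ ()
linked-++⁻ a [] (b ∷ ys) (r ∷ l) = [-] , l , λ { refl → r }
linked-++⁻ a (c ∷ t) ys (r ∷ l) = let (lt , lys , junction) = linked-++⁻ c t ys l in r ∷ lt , lys , junction

linked-++⁺ : ∀ {R : A → A → Set} a t ys → Linked R (a ∷ t) → Linked R ys →
             (∀ {b bs} → ys ≡ b ∷ bs → R (lastOr a t) b) → Linked R (a ∷ t ++ ys)
linked-++⁺ a [] [] _ _ _ = [-]
linked-++⁺ a [] (b ∷ ys) _ l junction = junction refl ∷ l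
linked-++⁺ a (c ∷ t) ys (r ∷ lt) lys junction = r ∷ linked-++⁺ c t ys lt lys junction

linked-tabulate⁺ : ∀ {R : A → A → Set} {n} {f : Fin (suc n) → A} →
                   (∀ (i : Fin n) → R (f (inject₁ i)) (f (fsuc i))) → Linked R (List.tabulate f)
linked-tabulate⁺ {n = zero} _ = [-]
linked-tabulate⁺ {n = suc n} {f} r = r fzero ∷ linked-tabulate⁺ {f = λ i → f (fsuc i)} (λ i → r (fsuc i))

linked-tabulate⁻ : ∀ {R : A → A → Set} {n} {f : Fin (suc n) → A} →
                   Linked R (List.tabulate f) → ∀ (i : Fin n) → R (f (inject₁ i)) (f (fsuc i))
linked-tabulate⁻ (r ∷ _) fzero = r
linked-tabulate⁻ {n = suc n} {f} (_ ∷ l) (fsuc i) = linked-tabulate⁻ {f = λ i → f (fsuc i)} l i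

tabulate-injective : ∀ {n} {f g : Fin n → A} → List.tabulate f ≡ List.tabulate g → ∀ i → f i ≡ g i
tabulate-injective eq fzero = Listₚ.∷-injectiveˡ eq
tabulate-injective eq (fsuc i) = tabulate-injective (Listₚ.∷-injectiveʳ eq) i

Follows : (A → A) → List A → Set
Follows τ = Linked (λ x y → τ x ≡ y)

follows-cong : ∀ {τ τ′ : A → A} {l} → (∀ {x} → x ∈ l → τ x ≡ τ′ x) → Follows τ′ l → Follows τ l
follows-cong _ [] = []
follows-cong _ [-] = [-]
follows-cong τ≗τ′ (step ∷ p) = trans (τ≗τ′ (here refl)) step ∷ follows-cong (λ x∈ → τ≗τ′ (there x∈)) p

follows-next : ∀ {τ : A → A} {u t x} → Follows τ (u ∷ t) → x ∈ u ∷ t → τ x ∈ t ⊎ x ≡ lastOr u t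
follows-next [-] (here refl) = inj₂ refl
follows-next (step ∷ _) (here refl) = inj₁ (here step)
follows-next (_ ∷ p) (there x∈) = Sum.map₁ there (follows-next p x∈)

cycle-next : ∀ {τ : A → A} {u t h x} → Follows τ (u ∷ t) → τ (lastOr u t) ≡ h → x ∈ u ∷ t → τ x ∈ t ⊎ τ x ≡ h
cycle-next p closes x∈ = Sum.map₂ (λ { refl → closes }) (follows-next p x∈)

head-∉-image : ∀ {τ : A → A} {v r h y} → Follows τ (v ∷ r) → τ (lastOr v r) ≡ h → Unique (v ∷ r) →
               h ∉ v ∷ r → y ∈ v ∷ r → τ y ≢ v
head-∉-image p closes (v∉r ∷ _) h∉ y∈ τy≡v with cycle-next p closes y∈
... | inj₁ τy∈r = All.lookup v∉r (subst (_∈ _) τy≡v τy∈r) refl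
... | inj₂ τy≡h = h∉ (here (trans (sym τy≡h) τy≡v))

cycle-injective : ∀ {τ : A → A} {u t h} → Follows τ (u ∷ t) → τ (lastOr u t) ≡ h → Unique (u ∷ t) → h ∉ t →
                  InjectiveOn τ (u ∷ t)
cycle-injective _ _ _ _ (here refl) (here refl) _ = refl
cycle-injective (step ∷ p) closes (_ ∷ u) h∉ (here refl) (there y∈) τu≡τy =
  ⊥-elim (head-∉-image p closes u h∉ y∈ (trans (sym τu≡τy) step))
cycle-injective (step ∷ p) closes (_ ∷ u) h∉ (there x∈) (here refl) τx≡τu =
  ⊥-elim (head-∉-image p closes u h∉ x∈ (trans τx≡τu step))
cycle-injective (_ ∷ p) closes (_ ∷ u) h∉ (there x∈) (there y∈) τx≡τy =
  cycle-injective p closes u (λ h∈ → h∉ (there h∈)) x∈ y∈ τx≡τy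

data EndsAtFirst {A : Set} (m : A) : List A → Set where
  stop : EndsAtFirst m (m ∷ [])
  skip : ∀ {u l} → u ≢ m → EndsAtFirst m l → EndsAtFirst m (u ∷ l)

endsAtFirst-last : ∀ {m a : A} {t} → EndsAtFirst m (a ∷ t) → lastOr a t ≡ m
endsAtFirst-last stop = refl
endsAtFirst-last (skip _ stop) = refl
endsAtFirst-last (skip _ (skip u≢m e)) = endsAtFirst-last (skip u≢m e)

follows-endsAtFirst-unique : ∀ {τ : A → A} {m a l l′} → Follows τ (a ∷ l) → Follows τ (a ∷ l′) →
                             EndsAtFirst m (a ∷ l) → EndsAtFirst m (a ∷ l′) → l ≡ l′
follows-endsAtFirst-unique _ _ stop stop = refl
follows-endsAtFirst-unique _ _ stop (skip a≢a _) = ⊥-elim (a≢a refl)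
follows-endsAtFirst-unique _ _ (skip a≢a _) stop = ⊥-elim (a≢a refl)
follows-endsAtFirst-unique (refl ∷ p) (refl ∷ p′) (skip _ e) (skip _ e′) =
  cong (_ ∷_) (follows-endsAtFirst-unique p p′ e e′)

module Cycles {A : Set} (_≟_ : DecidableEquality A) where

  nextIn : A → List A → A → A
  nextIn s [] x = x
  nextIn s (a ∷ r) x with a ≟ x
  ... | yes _ = fromMaybe s (List.head r)
  ... | no _ = nextIn s r x

  nextIn-follows : ∀ s u t → Unique (u ∷ t) →
                   Follows (nextIn s (u ∷ t)) (u ∷ t) × nextIn s (u ∷ t) (lastOr u t) ≡ s
  nextIn-follows s u [] _ with u ≟ u
  ... | yes _ = [-] , refl
  ... | no u≢u = ⊥-elim (u≢u refl)
  nextIn-follows s u (v ∷ t) (u∉ ∷ uvt) =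
    let (follows , closes) = nextIn-follows s v t uvt
    in head-step ∷ follows-cong skip-u follows , trans (skip-u (lastOr-∈ v t)) closes
    where
    skip-u : ∀ {x} → x ∈ v ∷ t → nextIn s (u ∷ v ∷ t) x ≡ nextIn s (v ∷ t) x
    skip-u {x} x∈ with u ≟ x
    ... | yes refl = ⊥-elim (All.lookup u∉ x∈ refl)
    ... | no _ = refl
    head-step : nextIn s (u ∷ v ∷ t) u ≡ v
    head-step with u ≟ u
    ... | yes _ = refl
    ... | no u≢u = ⊥-elim (u≢u refl)

  splitAfter : A → A → List A → List A × List A
  splitAfter m a [] = [] , []
  splitAfter m a (b ∷ r) with a ≟ m
  ... | yes _ = [] , b ∷ r
  ... | no _ = b ∷ proj₁ (splitAfter m b r) , proj₂ (splitAfter m b r)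

  splitAfter-++ : ∀ m a r → proj₁ (splitAfter m a r) ++ proj₂ (splitAfter m a r) ≡ r
  splitAfter-++ m a [] = refl
  splitAfter-++ m a (b ∷ r) with a ≟ m
  ... | yes _ = refl
  ... | no _ = cong (b ∷_) (splitAfter-++ m b r)

  splitAfter-endsAtFirst : ∀ m a r → m ∈ a ∷ r → EndsAtFirst m (a ∷ proj₁ (splitAfter m a r))
  splitAfter-endsAtFirst m a [] (here refl) = stop
  splitAfter-endsAtFirst m a (b ∷ r) m∈ with a ≟ m
  ... | yes refl = stop
  splitAfter-endsAtFirst m a (b ∷ r) (here refl) | no a≢a = ⊥-elim (a≢a refl)
  splitAfter-endsAtFirst m a (b ∷ r) (there m∈) | no a≢m = skip a≢m (splitAfter-endsAtFirst m b r m∈)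

open Cycles ℕₚ._≟_
open DecMembership ℕₚ._≟_ using (_∈?_)

DescentIffEven : ℕ → ℕ → Set
DescentIffEven x y = x > y ⇔ Even x

DumontAt : ℕ → ℕ → Set
DumontAt p y = (Even p → y < p) × (¬ Even p → y ≥ p)

dumontAt⇔descentIffEven : ∀ {p y} → DumontAt p y ⇔ DescentIffEven p y
dumontAt⇔descentIffEven {p} {y} = mk⇔ to from
  where
  to : DumontAt p y → DescentIffEven p y
  to (below , above) = mk⇔ even-of-descent below
    where
    even-of-descent : y < p → Even p
    even-of-descent y<p with even? p
    ... | yes ev = ev
    ... | no odd = ⊥-elim (<⇒≱ y<p (above odd))
  from : DescentIffEven p y → DumontAt p y
  from c = Equivalence.from c , λ odd → ≮⇒≥ (λ y<p → odd (Equivalence.to c y<p))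

dumontAt-fixed : ∀ {p} → ¬ Even p → DumontAt p p
dumontAt-fixed odd = (λ ev → ⊥-elim (odd ev)) , λ _ → ≤-refl

ascent⇒odd : ∀ {x y} → x ≤ y → DescentIffEven x y → ¬ Even x
ascent⇒odd x≤y c ev = ≤⇒≯ x≤y (Equivalence.from c ev)

odd-ascent : ∀ {x y} → x ≤ y → ¬ Even x → DescentIffEven x y
odd-ascent x≤y odd = mk⇔ (λ x>y → ⊥-elim (≤⇒≯ x≤y x>y)) (λ ev → ⊥-elim (odd ev))

LastOdd : List ℕ → Set
LastOdd [] = ⊤
LastOdd (a ∷ []) = ¬ Even a
LastOdd (a ∷ b ∷ r) = LastOdd (b ∷ r)

lastOdd-++⁻ : ∀ a t ys → LastOdd (a ∷ t ++ ys) → (ys ≡ [] → ¬ Even (lastOr a t)) × LastOdd ys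
lastOdd-++⁻ a [] [] odd = (λ _ → odd) , tt
lastOdd-++⁻ a [] (b ∷ ys) odd = (λ ()) , odd
lastOdd-++⁻ a (b ∷ t) ys odd = lastOdd-++⁻ b t ys odd

lastOdd-++⁺ : ∀ a t ys → (ys ≡ [] → ¬ Even (lastOr a t)) → LastOdd ys → LastOdd (a ∷ t ++ ys)
lastOdd-++⁺ a [] [] ifEmpty _ = ifEmpty refl
lastOdd-++⁺ a [] (b ∷ ys) _ odd = odd
lastOdd-++⁺ a (b ∷ t) ys ifEmpty odd = lastOdd-++⁺ b t ys ifEmpty odd

below-rest⇒odd : ∀ {e} ys → (∀ {x} → x ∈ ys → e < x) → (ys ≡ [] → ¬ Even e) →
                 (∀ {b bs} → ys ≡ b ∷ bs → DescentIffEven e b) → ¬ Even e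
below-rest⇒odd [] _ ifEmpty _ = ifEmpty refl
below-rest⇒odd (b ∷ _) e<ys _ junction = ascent⇒odd (<⇒≤ (e<ys (here refl))) (junction refl)

odd-max⇒lastOdd : ∀ {M} l → Unique l → M ∈ l → (∀ {x} → x ∈ l → x ≤ M) → ¬ Even M →
                  Linked DescentIffEven l → LastOdd l
odd-max⇒lastOdd (a ∷ []) _ (here refl) _ odd _ = odd
odd-max⇒lastOdd (a ∷ b ∷ r) ((a≢b ∷ _) ∷ _) (here refl) ≤M odd (c ∷ _) =
  ⊥-elim (odd (Equivalence.to c (≤∧≢⇒< (≤M (there (here refl))) (λ b≡a → a≢b (sym b≡a)))))
odd-max⇒lastOdd (a ∷ b ∷ r) (_ ∷ u) (there M∈) ≤M odd (_ ∷ alt) =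
  odd-max⇒lastOdd (b ∷ r) u M∈ (λ x∈ → ≤M (there x∈)) odd alt

cycle-descents⁺ : ∀ {τ u t x} → Follows τ (u ∷ t) → Linked DescentIffEven (u ∷ t) → ¬ Even (lastOr u t) →
                  lastOr u t ≤ τ (lastOr u t) → x ∈ u ∷ t → DescentIffEven x (τ x)
cycle-descents⁺ [-] _ odd ascends (here refl) = odd-ascent ascends odd
cycle-descents⁺ (refl ∷ _) (c ∷ _) _ _ (here refl) = c
cycle-descents⁺ (_ ∷ p) (_ ∷ alt) odd ascends (there x∈) = cycle-descents⁺ p alt odd ascends x∈

cycle-descents⁻ : ∀ {τ u t} → Follows τ (u ∷ t) → (∀ {x} → x ∈ u ∷ t → DescentIffEven x (τ x)) →
                  lastOr u t ≤ τ (lastOr u t) → Linked DescentIffEven (u ∷ t) × ¬ Even (lastOr u t)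
cycle-descents⁻ [-] desc ascends = [-] , ascent⇒odd ascends (desc (here refl))
cycle-descents⁻ (refl ∷ p) desc ascends =
  let (alt , odd) = cycle-descents⁻ p (λ x∈ → desc (there x∈)) ascends in desc (here refl) ∷ alt , odd

min-∈ : ∀ a r → min a r ∈ a ∷ r
min-∈ a r with argmin-sel (λ x → x) a r
... | inj₁ min≡a = here min≡a
... | inj₂ min∈r = there min∈r

min-≤ : ∀ a r {x} → x ∈ a ∷ r → min a r ≤ x
min-≤ a r (here refl) = min≤⊤ a r
min-≤ a r (there x∈) = All.lookup (min≤xs a r) x∈

min-sameMembers : ∀ a r a′ r′ → (∀ {x} → x ∈ a ∷ r → x ∈ a′ ∷ r′) → (∀ {x} → x ∈ a′ ∷ r′ → x ∈ a ∷ r) →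
                  min a r ≡ min a′ r′
min-sameMembers a r a′ r′ ⊆′ ⊇′ = ≤-antisym (min-≤ a r (⊇′ (min-∈ a′ r′))) (min-≤ a′ r′ (⊆′ (min-∈ a r)))

firstBlock : ℕ → List ℕ → List ℕ
firstBlock a r = a ∷ proj₁ (splitAfter (min a r) a r)

otherBlocks : ℕ → List ℕ → List ℕ
otherBlocks a r = proj₂ (splitAfter (min a r) a r)

-- Each block becomes a cycle. The recursion peels off a nonempty block, so any
-- fuel ≥ the length of the word suffices.
foata : ℕ → List ℕ → ℕ → ℕ
foata zero _ x = x
foata (suc fuel) [] x = x
foata (suc fuel) (a ∷ r) x with x ∈? firstBlock a r
... | yes _ = nextIn a (firstBlock a r) x
... | no _ = foata fuel (otherBlocks a r) x

foata-firstBlock : ∀ fuel a r {x} → x ∈ firstBlock a r → foata (suc fuel) (a ∷ r) x ≡ nextIn a (firstBlock a r) x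
foata-firstBlock fuel a r {x} x∈B with x ∈? firstBlock a r
... | yes _ = refl
... | no x∉B = ⊥-elim (x∉B x∈B)

foata-otherBlocks : ∀ fuel a r {x} → x ∉ firstBlock a r → foata (suc fuel) (a ∷ r) x ≡ foata fuel (otherBlocks a r) x
foata-otherBlocks fuel a r {x} x∉B with x ∈? firstBlock a r
... | yes x∈B = ⊥-elim (x∉B x∈B)
... | no _ = refl

module FirstBlock (fuel a : ℕ) (r : List ℕ) (uw : Unique (a ∷ r)) (fits : length r ≤ fuel) where

  m : ℕ
  m = min a r

  t : List ℕ
  t = proj₁ (splitAfter m a r)

  block : List ℕ
  block = firstBlock a r

  rest : List ℕ
  rest = otherBlocks a r

  τ : ℕ → ℕ
  τ = foata (suc fuel) (a ∷ r)

  τ-cycle : ℕ → ℕ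
  τ-cycle = nextIn a block

  w≡block++rest : a ∷ r ≡ block ++ rest
  w≡block++rest = cong (a ∷_) (sym (splitAfter-++ m a r))

  block-unique : Unique block
  block-unique = proj₁ (unique-++⁻ block (subst Unique w≡block++rest uw))

  rest-unique : Unique rest
  rest-unique = proj₁ (proj₂ (unique-++⁻ block (subst Unique w≡block++rest uw)))

  disjoint : ∀ {x} → x ∈ block → x ∉ rest
  disjoint = proj₂ (proj₂ (unique-++⁻ block (subst Unique w≡block++rest uw)))

  block⊆ : ∀ {x} → x ∈ block → x ∈ a ∷ r
  block⊆ {x} x∈ = subst (x ∈_) (sym w≡block++rest) (∈-++⁺ˡ x∈)

  rest⊆ : ∀ {x} → x ∈ rest → x ∈ a ∷ r
  rest⊆ {x} x∈ = subst (x ∈_) (sym w≡block++rest) (∈-++⁺ʳ block x∈)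

  split : ∀ {x} → x ∈ a ∷ r → x ∈ block ⊎ x ∈ rest
  split {x} x∈ = ∈-++⁻ block (subst (x ∈_) w≡block++rest x∈)

  block-endsAtFirst : EndsAtFirst m block
  block-endsAtFirst = splitAfter-endsAtFirst m a r (min-∈ a r)

  last≡m : lastOr a t ≡ m
  last≡m = endsAtFirst-last block-endsAtFirst

  m∈block : m ∈ block
  m∈block = subst (_∈ block) last≡m (lastOr-∈ a t)

  m<rest : ∀ {x} → x ∈ rest → m < x
  m<rest {x} x∈rest = ≤∧≢⇒< (min-≤ a r (rest⊆ x∈rest)) (λ { refl → disjoint m∈block x∈rest })

  last<rest : ∀ {x} → x ∈ rest → lastOr a t < x
  last<rest x∈rest = subst (_< _) (sym last≡m) (m<rest x∈rest)

  block-follows : Follows τ-cycle block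
  block-follows = proj₁ (nextIn-follows a a t block-unique)

  block-closes : τ-cycle (lastOr a t) ≡ a
  block-closes = proj₂ (nextIn-follows a a t block-unique)

  block-last-ascends : lastOr a t ≤ τ-cycle (lastOr a t)
  block-last-ascends = subst₂ _≤_ (sym last≡m) (sym block-closes) (min-≤ a r (here refl))

  τ-cycle-closed : ∀ {x} → x ∈ block → τ-cycle x ∈ block
  τ-cycle-closed x∈block = Sum.[ there , here ]′ (cycle-next block-follows block-closes x∈block)

  τ-cycle-injectiveOn : InjectiveOn τ-cycle block
  τ-cycle-injectiveOn =
    cycle-injective block-follows block-closes block-unique (Uniqueₚ.Unique[x∷xs]⇒x∉xs block-unique)

  τ-block : ∀ {x} → x ∈ block → τ x ≡ τ-cycle x
  τ-block = foata-firstBlock fuel a r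

  τ-rest : ∀ {x} → x ∈ rest → τ x ≡ foata fuel rest x
  τ-rest x∈rest = foata-otherBlocks fuel a r (λ x∈block → disjoint x∈block x∈rest)

  τ-min : τ m ≡ a
  τ-min = trans (τ-block m∈block) (trans (cong τ-cycle (sym last≡m)) block-closes)

  rest-fits : length rest ≤ fuel
  rest-fits = begin
    length rest            ≤⟨ m≤n+m (length rest) (length t) ⟩
    length t + length rest ≡⟨ sym (Listₚ.length-++ t) ⟩
    length (t ++ rest)     ≡⟨ cong length (splitAfter-++ m a r) ⟩
    length r               ≤⟨ fits ⟩
    fuel                   ∎
    where open ℕₚ.≤-Reasoning

  alt-split : Linked DescentIffEven (a ∷ r) →
              Linked DescentIffEven block × Linked DescentIffEven rest ×
              (∀ {b bs} → rest ≡ b ∷ bs → DescentIffEven (lastOr a t) b)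
  alt-split alt = linked-++⁻ a t rest (subst (Linked DescentIffEven) w≡block++rest alt)

  odd-split : LastOdd (a ∷ r) → (rest ≡ [] → ¬ Even (lastOr a t)) × LastOdd rest
  odd-split odd = lastOdd-++⁻ a t rest (subst LastOdd w≡block++rest odd)

foata-closed : ∀ fuel w → Unique w → length w ≤ fuel → ∀ {x} → x ∈ w → foata fuel w x ∈ w
foata-closed zero (_ ∷ _) _ () _
foata-closed (suc fuel) (a ∷ r) uw (s≤s fits) x∈ with FirstBlock.split fuel a r uw fits x∈
... | inj₁ x∈block = subst (_∈ a ∷ r) (sym (τ-block x∈block)) (block⊆ (τ-cycle-closed x∈block))
  where open FirstBlock fuel a r uw fits
... | inj₂ x∈rest =
  subst (_∈ a ∷ r) (sym (τ-rest x∈rest)) (rest⊆ (foata-closed fuel rest rest-unique rest-fits x∈rest))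
  where open FirstBlock fuel a r uw fits

foata-block-rest-apart : ∀ fuel a r uw fits → let open FirstBlock fuel a r uw fits in
                         ∀ {x y} → x ∈ block → y ∈ rest → τ x ≢ τ y
foata-block-rest-apart fuel a r uw fits x∈block y∈rest τx≡τy = disjoint (τ-cycle-closed x∈block)
  (subst (_∈ rest) (trans (sym (τ-rest y∈rest)) (trans (sym τx≡τy) (τ-block x∈block)))
     (foata-closed fuel rest rest-unique rest-fits y∈rest))
  where open FirstBlock fuel a r uw fits

foata-injectiveOn : ∀ fuel w → Unique w → length w ≤ fuel → InjectiveOn (foata fuel w) w
foata-injectiveOn zero (_ ∷ _) _ () _ _ _
foata-injectiveOn (suc fuel) (a ∷ r) uw (s≤s fits) x∈ y∈ τx≡τy
  with FirstBlock.split fuel a r uw fits x∈ | FirstBlock.split fuel a r uw fits y∈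
... | inj₁ x∈block | inj₁ y∈block =
  τ-cycle-injectiveOn x∈block y∈block (trans (sym (τ-block x∈block)) (trans τx≡τy (τ-block y∈block)))
  where open FirstBlock fuel a r uw fits
... | inj₁ x∈block | inj₂ y∈rest = ⊥-elim (foata-block-rest-apart fuel a r uw fits x∈block y∈rest τx≡τy)
... | inj₂ x∈rest | inj₁ y∈block = ⊥-elim (foata-block-rest-apart fuel a r uw fits y∈block x∈rest (sym τx≡τy))
... | inj₂ x∈rest | inj₂ y∈rest =
  foata-injectiveOn fuel rest rest-unique rest-fits x∈rest y∈rest
    (trans (sym (τ-rest x∈rest)) (trans τx≡τy (τ-rest y∈rest)))
  where open FirstBlock fuel a r uw fits

foata-descents⁺ : ∀ fuel w → Unique w → length w ≤ fuel → Linked DescentIffEven w → LastOdd w →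
                  ∀ {x} → x ∈ w → DescentIffEven x (foata fuel w x)
foata-descents⁺ zero (_ ∷ _) _ () _ _ _
foata-descents⁺ (suc fuel) (a ∷ r) uw (s≤s fits) alt odd {x} x∈ with FirstBlock.split fuel a r uw fits x∈
... | inj₁ x∈block =
  let (alt-block , _ , junction) = alt-split alt
      (ifEmpty , _) = odd-split odd
  in subst (DescentIffEven x) (sym (τ-block x∈block))
       (cycle-descents⁺ block-follows alt-block (below-rest⇒odd rest last<rest ifEmpty junction)
          block-last-ascends x∈block)
  where open FirstBlock fuel a r uw fits
... | inj₂ x∈rest = subst (DescentIffEven x) (sym (τ-rest x∈rest))
  (foata-descents⁺ fuel rest rest-unique rest-fits (proj₁ (proj₂ (alt-split alt))) (proj₂ (odd-split odd)) x∈rest)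
  where open FirstBlock fuel a r uw fits

foata-descents⁻ : ∀ fuel w → Unique w → length w ≤ fuel → (∀ {x} → x ∈ w → DescentIffEven x (foata fuel w x)) →
                  Linked DescentIffEven w × LastOdd w
foata-descents⁻ _ [] _ _ _ = [] , tt
foata-descents⁻ zero (_ ∷ _) _ () _
foata-descents⁻ (suc fuel) (a ∷ r) uw (s≤s fits) desc =
  subst (Linked DescentIffEven) (sym w≡block++rest)
    (linked-++⁺ a t rest (proj₁ block-desc) (proj₁ rest-desc) junction) ,
  subst LastOdd (sym w≡block++rest) (lastOdd-++⁺ a t rest (λ _ → proj₂ block-desc) (proj₂ rest-desc))
  where
  open FirstBlock fuel a r uw fits
  block-desc : Linked DescentIffEven block × ¬ Even (lastOr a t)
  block-desc = cycle-descents⁻ block-follows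
    (λ x∈block → subst (DescentIffEven _) (τ-block x∈block) (desc (block⊆ x∈block))) block-last-ascends
  rest-desc : Linked DescentIffEven rest × LastOdd rest
  rest-desc = foata-descents⁻ fuel rest rest-unique rest-fits
    (λ x∈rest → subst (DescentIffEven _) (τ-rest x∈rest) (desc (rest⊆ x∈rest)))
  junction : ∀ {b bs} → rest ≡ b ∷ bs → DescentIffEven (lastOr a t) b
  junction rest≡ = odd-ascent (<⇒≤ (last<rest (subst (_ ∈_) (sym rest≡) (here refl)))) (proj₂ block-desc)

-- The word is recovered from the permutation: its first block is the cycle of its
-- minimum, read from τ(min) = the first letter.
foata-injective : ∀ fuel w w′ → Unique w → Unique w′ → length w ≤ fuel → length w′ ≤ fuel →
                  (∀ {x} → x ∈ w → x ∈ w′) → (∀ {x} → x ∈ w′ → x ∈ w) →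
                  (∀ {x} → x ∈ w → foata fuel w x ≡ foata fuel w′ x) → w ≡ w′
foata-injective _ [] [] _ _ _ _ _ _ _ = refl
foata-injective _ [] (_ ∷ _) _ _ _ _ _ w′⊆w _ with w′⊆w (here refl)
... | ()
foata-injective _ (_ ∷ _) [] _ _ _ _ w⊆w′ _ _ with w⊆w′ (here refl)
... | ()
foata-injective zero (_ ∷ _) (_ ∷ _) _ _ () _ _ _ _
foata-injective (suc fuel) (a ∷ r) (a′ ∷ r′) uw uw′ (s≤s fits) (s≤s fits′) w⊆w′ w′⊆w agree =
  begin
    a ∷ r              ≡⟨ W.w≡block++rest ⟩
    W.block ++ W.rest  ≡⟨ cong₂ _++_ block≡block′ rest≡rest′ ⟩
    W′.block ++ W′.rest ≡⟨ sym W′.w≡block++rest ⟩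
    a′ ∷ r′            ∎
  where
  open ≡-Reasoning
  module W = FirstBlock fuel a r uw fits
  module W′ = FirstBlock fuel a′ r′ uw′ fits′
  m≡m′ : W.m ≡ W′.m
  m≡m′ = min-sameMembers a r a′ r′ w⊆w′ w′⊆w
  a≡a′ : a ≡ a′
  a≡a′ = trans (sym W.τ-min) (trans (agree (W.block⊆ W.m∈block)) (trans (cong W′.τ m≡m′) W′.τ-min))
  block′-follows : Follows W.τ W′.block
  block′-follows = follows-cong (λ x∈ → trans (agree (w′⊆w (W′.block⊆ x∈))) (W′.τ-block x∈)) W′.block-follows
  same-start : a ≡ a′ → Follows W.τ (a′ ∷ W′.t) → EndsAtFirst W.m (a′ ∷ W′.t) → W.block ≡ a′ ∷ W′.t
  same-start refl follows′ ends′ =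
    cong (a ∷_) (follows-endsAtFirst-unique (follows-cong W.τ-block W.block-follows) follows′
                   W.block-endsAtFirst ends′)
  block≡block′ : W.block ≡ W′.block
  block≡block′ = same-start a≡a′ block′-follows (subst (λ z → EndsAtFirst z W′.block) (sym m≡m′) W′.block-endsAtFirst)
  rest⊆rest′ : ∀ {x} → x ∈ W.rest → x ∈ W′.rest
  rest⊆rest′ {x} x∈rest with W′.split (w⊆w′ (W.rest⊆ x∈rest))
  ... | inj₁ x∈block′ = ⊥-elim (W.disjoint (subst (x ∈_) (sym block≡block′) x∈block′) x∈rest)
  ... | inj₂ x∈rest′ = x∈rest′
  rest′⊆rest : ∀ {x} → x ∈ W′.rest → x ∈ W.rest
  rest′⊆rest {x} x∈rest′ with W.split (w′⊆w (W′.rest⊆ x∈rest′))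
  ... | inj₁ x∈block = ⊥-elim (W′.disjoint (subst (x ∈_) block≡block′ x∈block) x∈rest′)
  ... | inj₂ x∈rest = x∈rest
  rest≡rest′ : W.rest ≡ W′.rest
  rest≡rest′ = foata-injective fuel W.rest W′.rest W.rest-unique W′.rest-unique W.rest-fits W′.rest-fits
    rest⊆rest′ rest′⊆rest
    (λ x∈rest → trans (sym (W.τ-rest x∈rest)) (trans (agree (W.rest⊆ x∈rest)) (W′.τ-rest (rest⊆rest′ x∈rest))))

≗-lookup⇒≡ : ∀ {n} {xs ys : Vec A n} → (∀ i → lookup xs i ≡ lookup ys i) → xs ≡ ys
≗-lookup⇒≡ {xs = xs} {ys} xs≗ys = begin
  xs                  ≡⟨ sym (Vecₚ.tabulate∘lookup xs) ⟩
  tabulate (lookup xs) ≡⟨ Vecₚ.tabulate-cong xs≗ys ⟩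
  tabulate (lookup ys) ≡⟨ Vecₚ.tabulate∘lookup ys ⟩
  ys                  ∎
  where open ≡-Reasoning

pos-injective : ∀ {n} {i j : Fin n} → pos i ≡ pos j → i ≡ j
pos-injective eq = Finₚ.toℕ-injective (suc-injective eq)

-- Left inverse of pos; the value outside 1 … n+1 is arbitrary.
fromPos : ∀ {n} → ℕ → Fin (suc n)
fromPos zero = fzero
fromPos {n} (suc y) with y ℕₚ.<? suc n
... | yes y<n = fromℕ< y<n
... | no _ = fzero

fromPos-pos : ∀ {n} (j : Fin (suc n)) → fromPos (pos j) ≡ j
fromPos-pos {n} j with toℕ j ℕₚ.<? suc n
... | yes j<n = Finₚ.fromℕ<-toℕ j j<n
... | no j≮n = ⊥-elim (j≮n (Finₚ.toℕ<n j))

oneLine : ∀ {n} → Vec (Fin n) n → List ℕ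
oneLine v = List.tabulate (σ v)

Φ : ∀ {n} → Vec (Fin (suc n)) (suc n) → Vec (Fin (suc n)) (suc n)
Φ {n} v = tabulate (λ j → fromPos (foata (suc n) (oneLine v) (pos j)))

module OneLine {n : ℕ} (v : Vec (Fin (suc n)) (suc n)) (perm : IsPerm v) where

  w : List ℕ
  w = oneLine v

  w-unique : Unique w
  w-unique = Uniqueₚ.tabulate⁺ (λ eq → perm _ _ (pos-injective eq))

  w-tail : List ℕ
  w-tail = List.tabulate (λ i → σ v (fsuc i))

  tail-fits : length w-tail ≤ n
  tail-fits = ≤-reflexive (Listₚ.length-tabulate (λ i → σ v (fsuc i)))

  w-fits : length w ≤ suc n
  w-fits = s≤s tail-fits

  ∈w⇒pos : ∀ {x} → x ∈ w → ∃ λ j → x ≡ pos j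
  ∈w⇒pos x∈ = let (i , x≡) = ∈-tabulate⁻ {f = σ v} x∈ in lookup v i , x≡

  pos∈w : ∀ j → pos j ∈ w
  pos∈w j = let (i , vi≡j) = perm-surjective {v = v} perm j in subst (λ z → pos z ∈ w) vi≡j (∈-tabulate⁺ {f = σ v} i)

  τ : ℕ → ℕ
  τ = foata (suc n) w

  τ-pos : ∀ j → ∃ λ j′ → τ (pos j) ≡ pos j′
  τ-pos j = ∈w⇒pos (foata-closed (suc n) w w-unique w-fits (pos∈w j))

  min≡1 : min (σ v fzero) w-tail ≡ 1
  min≡1 = ≤-antisym (min-≤ (σ v fzero) w-tail (pos∈w fzero))
    (let (j , min≡) = ∈w⇒pos (min-∈ (σ v fzero) w-tail) in subst (1 ≤_) (sym min≡) (s≤s z≤n))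

  τ-1 : τ 1 ≡ first v
  τ-1 = subst (λ z → τ z ≡ first v) min≡1
    (FirstBlock.τ-min n (σ v fzero) w-tail w-unique tail-fits)

  descents⁺ : (∀ i → DescentIffEven (σ v (inject₁ i)) (σ v (fsuc i))) → ¬ Even (suc n) →
              ∀ {x} → x ∈ w → DescentIffEven x (τ x)
  descents⁺ alt odd = foata-descents⁺ (suc n) w w-unique w-fits (linked-tabulate⁺ {f = σ v} alt)
    (odd-max⇒lastOdd w w-unique (subst (_∈ w) (cong suc (Finₚ.toℕ-fromℕ n)) (pos∈w (fromℕ n))) ≤max odd
      (linked-tabulate⁺ {f = σ v} alt))
    where
    ≤max : ∀ {x} → x ∈ w → x ≤ suc n
    ≤max x∈ = let (j , x≡) = ∈w⇒pos x∈ in subst (_≤ suc n) (sym x≡) (Finₚ.toℕ<n j)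

  descents⁻ : (∀ {x} → x ∈ w → DescentIffEven x (τ x)) → ∀ i → DescentIffEven (σ v (inject₁ i)) (σ v (fsuc i))
  descents⁻ desc = linked-tabulate⁻ {f = σ v} (proj₁ (foata-descents⁻ (suc n) w w-unique w-fits desc))

  σ-Φ : ∀ j → σ (Φ v) j ≡ τ (pos j)
  σ-Φ j = let (j′ , τj≡j′) = τ-pos j in begin
    σ (Φ v) j                      ≡⟨ cong pos (Vecₚ.lookup∘tabulate (λ i → fromPos {n} (τ (pos i))) j) ⟩
    pos (fromPos {n} (τ (pos j)))  ≡⟨ cong (λ z → pos (fromPos {n} z)) τj≡j′ ⟩
    pos (fromPos {n} (pos j′))     ≡⟨ cong pos (fromPos-pos j′) ⟩
    pos j′                         ≡⟨ sym τj≡j′ ⟩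
    τ (pos j)                      ∎
    where open ≡-Reasoning

  Φ-perm : IsPerm (Φ v)
  Φ-perm i j eq = pos-injective (foata-injectiveOn (suc n) w w-unique w-fits (pos∈w i) (pos∈w j)
    (trans (sym (σ-Φ i)) (trans (cong pos eq) (σ-Φ j))))

  Φ-first : first (Φ v) ≡ first v
  Φ-first = trans (σ-Φ fzero) τ-1

  Φ-dumont : (∀ {x} → x ∈ w → DescentIffEven x (τ x)) → InD2 (Φ v)
  Φ-dumont desc = Φ-perm , λ j → Equivalence.from dumontAt⇔descentIffEven
    (subst (DescentIffEven (pos j)) (sym (σ-Φ j)) (desc (pos∈w j)))

  dumont-Φ : InD2 (Φ v) → ∀ {x} → x ∈ w → DescentIffEven x (τ x)
  dumont-Φ (_ , dumont) x∈ = let (j , x≡) = ∈w⇒pos x∈ in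
    subst (λ z → DescentIffEven z (τ z)) (sym x≡)
      (subst (DescentIffEven (pos j)) (σ-Φ j) (Equivalence.to dumontAt⇔descentIffEven (dumont j)))

Φ-injective : ∀ {n} {v v′ : Vec (Fin (suc n)) (suc n)} → IsPerm v → IsPerm v′ → Φ v ≡ Φ v′ → v ≡ v′
Φ-injective {n} {v} {v′} perm perm′ Φv≡Φv′ =
  ≗-lookup⇒≡ (λ i → pos-injective (tabulate-injective {f = σ v} {g = σ v′} w≡w′ i))
  where
  module V = OneLine v perm
  module V′ = OneLine v′ perm′
  w⊆w′ : ∀ {x} → x ∈ V.w → x ∈ V′.w
  w⊆w′ x∈ = let (j , x≡) = V.∈w⇒pos x∈ in subst (_∈ V′.w) (sym x≡) (V′.pos∈w j)
  w′⊆w : ∀ {x} → x ∈ V′.w → x ∈ V.w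
  w′⊆w x∈ = let (j , x≡) = V′.∈w⇒pos x∈ in subst (_∈ V.w) (sym x≡) (V.pos∈w j)
  agree : ∀ {x} → x ∈ V.w → V.τ x ≡ V′.τ x
  agree x∈ = let (j , x≡) = V.∈w⇒pos x∈ in subst (λ z → V.τ z ≡ V′.τ z) (sym x≡)
    (trans (sym (V.σ-Φ j)) (trans (cong (λ u → σ u j) Φv≡Φv′) (V′.σ-Φ j)))
  w≡w′ : oneLine v ≡ oneLine v′
  w≡w′ = foata-injective (suc n) V.w V′.w V.w-unique V′.w-unique V.w-fits V′.w-fits w⊆w′ w′⊆w agree

-- Pigeonhole: Φ is injective on the finite set of permutations.
Φ-surjective : ∀ {n} {y : Vec (Fin (suc n)) (suc n)} → IsPerm y → ∃ λ v → IsPerm v × Φ v ≡ y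
Φ-surjective {n} perm-y =
  let (v , v∈ , Φv≡y) = injectiveOn⇒surjectiveOn (Vecₚ.≡-dec Finₚ._≟_) Φ
                          (Uniqueₚ.filter⁺ isPerm? (allVecs-unique (suc n) (suc n)))
                          (λ u∈ v∈ → Φ-injective (isPerm u∈) (isPerm v∈))
                          (λ {v} v∈ → ∈-filter⁺ isPerm? (∈-allVecs _) (OneLine.Φ-perm v (isPerm v∈)))
                          (∈-filter⁺ isPerm? (∈-allVecs _) perm-y)
  in v , isPerm v∈ , Φv≡y
  where
  isPerm : ∀ {v} → v ∈ filter isPerm? (allVecs (suc n) (suc n)) → IsPerm v
  isPerm v∈ = proj₂ (∈-filter⁻ isPerm? {xs = allVecs (suc n) (suc n)} v∈)

foata-count : ∀ n k → ¬ Even (suc n) →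
              countVecs {suc n} {suc n} (λ v → inD? v ×-dec (first v ℕₚ.≟ suc k)) ≡
              countVecs {suc n} {suc n} (λ v → inD2? v ×-dec (first v ℕₚ.≟ suc k))
foata-count n k odd = countVecs-bijection (λ v → inD? v ×-dec (first v ℕₚ.≟ suc k))
  (λ v → inD2? v ×-dec (first v ℕₚ.≟ suc k)) (Φ {n}) injective (λ {v} → into {v}) (λ {y} → onto {y})
  where
  injective : ∀ {u v} → InD u × first u ≡ suc k → InD v × first v ≡ suc k → Φ u ≡ Φ v → u ≡ v
  injective {u} {v} ((perm-u , _) , _) ((perm-v , _) , _) = Φ-injective {v = u} {v} perm-u perm-v
  into : ∀ {v} → InD v × first v ≡ suc k → InD2 (Φ v) × first (Φ v) ≡ suc k
  into {v} ((perm , alt) , first≡) = Φ-dumont (descents⁺ alt odd) , trans Φ-first first≡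
    where open OneLine v perm
  onto : ∀ {y} → InD2 y × first y ≡ suc k → ∃ λ v → (InD v × first v ≡ suc k) × Φ v ≡ y
  onto {y} (dumont , first≡) =
    let (v , perm , Φv≡y) = Φ-surjective {y = y} (proj₁ dumont)
        open OneLine v perm
    in v , ((perm , descents⁻ (dumont-Φ (subst InD2 (sym Φv≡y) dumont))) ,
            trans (sym Φ-first) (trans (cong first Φv≡y) first≡)) , Φv≡y

lookup-∷ʳ-inject₁ : ∀ {n} (xs : Vec A n) x i → lookup (xs ∷ʳ x) (inject₁ i) ≡ lookup xs i
lookup-∷ʳ-inject₁ (_ ∷ _) _ fzero = refl
lookup-∷ʳ-inject₁ (_ ∷ xs) x (fsuc i) = lookup-∷ʳ-inject₁ xs x i

lookup-∷ʳ-last : ∀ {n} (xs : Vec A n) x → lookup (xs ∷ʳ x) (fromℕ n) ≡ x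
lookup-∷ʳ-last [] _ = refl
lookup-∷ʳ-last (_ ∷ xs) x = lookup-∷ʳ-last xs x

data InjectOrLast : ∀ {n} → Fin (suc n) → Set where
  inject : ∀ {n} (j : Fin n) → InjectOrLast (inject₁ j)
  last : ∀ {n} → InjectOrLast (fromℕ n)

injectOrLast : ∀ {n} (i : Fin (suc n)) → InjectOrLast i
injectOrLast {zero} fzero = last
injectOrLast {suc n} fzero = inject fzero
injectOrLast {suc n} (fsuc i) with injectOrLast i
... | inject j = inject (fsuc j)
... | last = last

extend : ∀ {n} → Vec (Fin n) n → Vec (Fin (suc n)) (suc n)
extend {n} u = Vec.map inject₁ u ∷ʳ fromℕ n

lookup-extend-inject₁ : ∀ {n} (u : Vec (Fin n) n) j → lookup (extend u) (inject₁ j) ≡ inject₁ (lookup u j)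
lookup-extend-inject₁ u j = trans (lookup-∷ʳ-inject₁ (Vec.map inject₁ u) _ j) (Vecₚ.lookup-map j inject₁ u)

lookup-extend-last : ∀ {n} (u : Vec (Fin n) n) → lookup (extend u) (fromℕ n) ≡ fromℕ n
lookup-extend-last u = lookup-∷ʳ-last (Vec.map inject₁ u) _

pos-inject₁ : ∀ {n} (j : Fin n) → pos (inject₁ j) ≡ pos j
pos-inject₁ j = cong suc (Finₚ.toℕ-inject₁ j)

σ-extend-inject₁ : ∀ {n} (u : Vec (Fin n) n) j → σ (extend u) (inject₁ j) ≡ σ u j
σ-extend-inject₁ u j = trans (cong pos (lookup-extend-inject₁ u j)) (pos-inject₁ (lookup u j))

extend-first : ∀ {n} (u : Vec (Fin (suc n)) (suc n)) → first (extend u) ≡ first u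
extend-first u = σ-extend-inject₁ u fzero

extend-injective : ∀ {n} {u u′ : Vec (Fin n) n} → extend u ≡ extend u′ → u ≡ u′
extend-injective {u = u} {u′} eq = ≗-lookup⇒≡ λ j → Finₚ.inject₁-injective
  (trans (sym (lookup-extend-inject₁ u j))
    (trans (cong (λ z → lookup z (inject₁ j)) eq) (lookup-extend-inject₁ u′ j)))

extend-dumont : ∀ {n} {u : Vec (Fin n) n} → ¬ Even (suc n) → InD2 u → InD2 (extend u)
extend-dumont {n} {u} odd (perm , dumont) = perm′ , dumont′
  where
  perm′ : IsPerm (extend u)
  perm′ i₁ i₂ eq with injectOrLast i₁ | injectOrLast i₂
  ... | inject j₁ | inject j₂ = cong inject₁ (perm j₁ j₂ (Finₚ.inject₁-injective
          (trans (sym (lookup-extend-inject₁ u j₁)) (trans eq (lookup-extend-inject₁ u j₂)))))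
  ... | inject j | last = ⊥-elim (Finₚ.fromℕ≢inject₁
          (trans (sym (lookup-extend-last u)) (trans (sym eq) (lookup-extend-inject₁ u j))))
  ... | last | inject j = ⊥-elim (Finₚ.fromℕ≢inject₁
          (trans (sym (lookup-extend-last u)) (trans eq (lookup-extend-inject₁ u j))))
  ... | last | last = refl
  dumont′ : ∀ i → DumontAt (pos i) (σ (extend u) i)
  dumont′ i with injectOrLast i
  ... | inject j = subst₂ DumontAt (sym (pos-inject₁ j)) (sym (σ-extend-inject₁ u j)) (dumont j)
  ... | last = subst (DumontAt _) (sym (cong pos (lookup-extend-last u)))
                 (dumontAt-fixed (subst (λ z → ¬ Even (suc z)) (sym (Finₚ.toℕ-fromℕ n)) odd))

extend-dumont⁻ : ∀ {n} {u : Vec (Fin n) n} → InD2 (extend u) → InD2 u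
extend-dumont⁻ {u = u} (perm , dumont) =
  perm′ , λ j → subst₂ DumontAt (pos-inject₁ j) (σ-extend-inject₁ u j) (dumont (inject₁ j))
  where
  perm′ : IsPerm u
  perm′ j₁ j₂ eq = Finₚ.inject₁-injective (perm (inject₁ j₁) (inject₁ j₂)
    (trans (lookup-extend-inject₁ u j₁) (trans (cong inject₁ eq) (sym (lookup-extend-inject₁ u j₂)))))

dumont-fixes-last : ∀ {n} {y : Vec (Fin (suc n)) (suc n)} → ¬ Even (suc n) → InD2 y → lookup y (fromℕ n) ≡ fromℕ n
dumont-fixes-last {n} {y} odd (_ , dumont) = pos-injective (≤-antisym
  (subst (σ y (fromℕ n) ≤_) (sym pos-last) (Finₚ.toℕ<n (lookup y (fromℕ n))))
  (proj₂ (dumont (fromℕ n)) (subst (λ z → ¬ Even z) (sym pos-last) odd)))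
  where
  pos-last : pos (fromℕ n) ≡ suc n
  pos-last = cong suc (Finₚ.toℕ-fromℕ n)

extend-surjective : ∀ {n} {y : Vec (Fin (suc n)) (suc n)} → ¬ Even (suc n) → InD2 y → ∃ λ u → extend u ≡ y
extend-surjective {n} {y} odd dumont@(perm , _) = u , ≗-lookup⇒≡ agree
  where
  fixes : lookup y (fromℕ n) ≡ fromℕ n
  fixes = dumont-fixes-last {y = y} odd dumont
  not-last : ∀ j → n ≢ toℕ (lookup y (inject₁ j))
  not-last j n≡ = Finₚ.fromℕ≢inject₁ (perm (fromℕ n) (inject₁ j)
    (trans fixes (Finₚ.toℕ-injective (trans (Finₚ.toℕ-fromℕ n) n≡))))
  u : Vec (Fin n) n
  u = tabulate (λ j → lower₁ (lookup y (inject₁ j)) (not-last j))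
  agree : ∀ i → lookup (extend u) i ≡ lookup y i
  agree i with injectOrLast i
  ... | inject j = trans (lookup-extend-inject₁ u j)
          (trans (cong inject₁ (Vecₚ.lookup∘tabulate _ j)) (Finₚ.inject₁-lower₁ _ (not-last j)))
  ... | last = trans (lookup-extend-last u) (sym fixes)

extend-count : ∀ n k → ¬ Even (suc (suc n)) →
               D2count n k ≡ countVecs {suc (suc n)} {suc (suc n)} (λ v → inD2? v ×-dec (first v ℕₚ.≟ suc k))
extend-count n k odd = countVecs-bijection (λ v → inD2? v ×-dec (first v ℕₚ.≟ suc k))
  (λ v → inD2? v ×-dec (first v ℕₚ.≟ suc k)) extend
  (λ {u} {u′} _ _ → extend-injective {u = u} {u′}) (λ {u} → into {u}) (λ {y} → onto {y})
  where
  into : ∀ {u} → InD2 u × first u ≡ suc k → InD2 (extend u) × first (extend u) ≡ suc k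
  into {u} (dumont , first≡) = extend-dumont {u = u} odd dumont , trans (extend-first u) first≡
  onto : ∀ {y} → InD2 y × first y ≡ suc k → ∃ λ u → (InD2 u × first u ≡ suc k) × extend u ≡ y
  onto {y} (dumont , first≡) =
    let (u , extend-u≡y) = extend-surjective {y = y} odd dumont
    in u , (extend-dumont⁻ {u = u} (subst InD2 (sym extend-u≡y) dumont) ,
            trans (sym (extend-first u)) (trans (cong first extend-u≡y) first≡)) , extend-u≡y

odd-suc-2* : ∀ m → ¬ Even (suc (2 * m))
odd-suc-2* m 2∣1+2m with ∣1⇒≡1 (∣m+n∣m⇒∣n (subst (2 ∣_) (+-comm 1 (2 * m)) 2∣1+2m) (m∣m*n m))
... | ()

corollary2p7 : (m k : ℕ) → 1 ≤ m → 1 ≤ k → k ≤ 2 * m ∸ 1 →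
    K m k ≡ D2count (2 * m ∸ 1) k
corollary2p7 (suc m) k _ _ _ = trans (foata-count (2 * suc m) k (odd-suc-2* (suc m)))
  (sym (extend-count (2 * suc m ∸ 1) k (odd-suc-2* (suc m))))
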